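{- The map sending $\Phi\in\mathbb{Q}\mathrm{Vir}$ to its generating series $\Phi(x)\in\mathbb{Q}[[x]]$ is a homomorphism of integro-differential rings $$\Big(\mathbb{Q}\mathrm{Vir},\partial,\int_{e^X}\Big)\longrightarrow\Big(\mathbb{Q}[[x]],\tfrac{d}{dx},\int_0^x\Big),$$ i.e. it is a ring homomorphism satisfying $(\Phi')(x)=\frac{d}{dx}\Phi(x)$ and $\big(\int_{e^X}\Phi\big)(x)=\int_0^x\Phi(t)\,dt$ for all $\Phi$.
   Context: A (set) species is a functor from finite sets with bijections to finite sets; species are identified up to natural isomorphism, with sum (disjoint union), product $(FG)[U]=\bigsqcup_{V\sqcup W=U}F[V]\times G[W]$ and derivative $F'[U]=F[U\sqcup\{*\}]$. Every species is uniquely a summable sum of molecular species with $\mathbb{N}$ coefficients. $\mathbb{Q}\mathrm{Vir}$ is the ring of rational species: formal sums $\sum_M c_M M$ of molecular species with $c_M\in\mathbb{Q}$, finitely many nonzero in each cardinality, with operations (including the derivative $\partial\Phi=\Phi'$) extended from species by $\mathbb{Q}$-linearity and summability. $\Phi_n$ is the cardinality-$n$ component and $\Phi^{(n)}$ the $n$-th derivative. $X$ is the singleton species and $e^X=\sum_{n\ge0}X^n/n!$. The Joyal integral with respect to $e^X$ is $\int_{e^X}\Phi:=\sum_{i\ge1}(-1)^{i-1}\frac{X^i}{i!}\Phi^{(i-1)}$. The generating series of a species $F$ is $F(x)=\sum_{n\ge0}|F[\{1,\dots,n\}]|\,\frac{x^n}{n!}$, extended $\mathbb{Q}$-linearly (and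 summably) to $\mathbb{Q}\mathrm{Vir}$. On $\mathbb{Q}[[x]]$, $\int_0^x$ is the usual termwise integration $x^n\mapsto x^{n+1}/(n+1)$. An integro-differential ring is a commutative ring with a derivation $\partial$ and additive $\int$ satisfying $\partial\int=\mathrm{id}$ and $\int(\partial(x)\int y)=x\int y-\int(xy)$; a homomorphism is a ring homomorphism commuting with both operators. -}

module Defs where

open import Data.Nat using (ℕ; zero; suc; _+_; _*_; _∸_; _!)
open import Data.Nat.Properties using (_!≢0)
open import Data.Fin using (Fin; zero; suc; splitAt; _↑ˡ_; _↑ʳ_; combine; remQuot)
open import Data.Fin.Permutation
  using (Permutation; Permutation′; permutation; _⟨$⟩ʳ_; _⟨$⟩ˡ_; inverseˡ; inverseʳ; lift₀; ↔⇒≡; id; _∘ₚ_)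
  renaming (_≈_ to _≈ₚ_)
open import Data.Bool using (Bool; true; false; not)
open import Data.Vec using (Vec; []; _∷_; lookup; tabulate; map)
open import Data.Vec.Properties using (lookup∘tabulate; lookup-map)
open import Data.Sum using (inj₁; inj₂)
open import Data.Product using (Σ; _×_; _,_; proj₁; proj₂)
open import Data.List using (List; []; _∷_; _++_; concatMap; upTo; applyUpTo)
import Data.List as L
open import Data.List.Relation.Unary.All using (All)
open import Data.Empty using (⊥-elim)
open import Data.Integer using (ℤ; +_; -[1+_])
open import Data.Rational using (ℚ; _/_; 0ℚ; 1ℚ)
import Data.Rational as Q
open import Relation.Binary.PropositionalEquality
  using (_≡_; _≢_; refl; sym; trans; cong; subst)

-- Set species, on the skeleton {Fin n} of finite sets with bijections.
-- F[Fin m] = Fin (card m); a bijection Fin m ↔ Fin n is transported to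
-- a map Fin (card m) → Fin (card n).

record Species : Set where
  field
    card : ℕ → ℕ
    act  : ∀ {m n} → Permutation m n → Fin (card m) → Fin (card n)
open Species public

record IsSpecies (F : Species) : Set where
  field
    act-id   : ∀ {n} (x : Fin (card F n)) → act F (id {n}) x ≡ x
    act-∘    : ∀ {m n o} (π : Permutation m n) (ρ : Permutation n o)
               (x : Fin (card F m)) → act F (π ∘ₚ ρ) x ≡ act F ρ (act F π x)
    act-cong : ∀ {m n} (π ρ : Permutation m n) → π ≈ₚ ρ →
               (x : Fin (card F m)) → act F π x ≡ act F ρ x

-- Subsets of Fin n as Bool vectors, their cardinality and the
-- order-preserving enumeration of their elements.

∣_∣ₛ : ∀ {n} → Vec Bool n → ℕ
∣ [] ∣ₛ = 0
∣ true ∷ v ∣ₛ = suc ∣ v ∣ₛ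
∣ false ∷ v ∣ₛ = ∣ v ∣ₛ

elt : ∀ {n} (v : Vec Bool n) → Fin ∣ v ∣ₛ → Fin n
elt (true ∷ v) zero = zero
elt (true ∷ v) (suc i) = suc (elt v i)
elt (false ∷ v) i = suc (elt v i)

pos : ∀ {n} (v : Vec Bool n) (u : Fin n) → lookup v u ≡ true → Fin ∣ v ∣ₛ
pos (true ∷ v) zero p = zero
pos (true ∷ v) (suc u) p = suc (pos v u p)
pos (false ∷ v) zero ()
pos (false ∷ v) (suc u) p = pos v u p

elt-true : ∀ {n} (v : Vec Bool n) (i : Fin ∣ v ∣ₛ) → lookup v (elt v i) ≡ true
elt-true (true ∷ v) zero = refl
elt-true (true ∷ v) (suc i) = elt-true v i
elt-true (false ∷ v) i = elt-true v i

elt-pos : ∀ {n} (v : Vec Bool n) u p → elt v (pos v u p) ≡ u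
elt-pos (true ∷ v) zero p = refl
elt-pos (true ∷ v) (suc u) p = cong suc (elt-pos v u p)
elt-pos (false ∷ v) zero ()
elt-pos (false ∷ v) (suc u) p = cong suc (elt-pos v u p)

pos-elt : ∀ {n} (v : Vec Bool n) i p → pos v (elt v i) p ≡ i
pos-elt (true ∷ v) zero p = refl
pos-elt (true ∷ v) (suc i) p = cong suc (pos-elt v i p)
pos-elt (false ∷ v) i p = pos-elt v i p

pos-cong : ∀ {n} (v : Vec Bool n) {u u'} (e : u ≡ u') p q → pos v u p ≡ pos v u' q
pos-cong (true ∷ v) {zero} refl p q = refl
pos-cong (true ∷ v) {suc u} refl p q = cong suc (pos-cong v refl p q)
pos-cong (false ∷ v) {zero} refl () q
pos-cong (false ∷ v) {suc u} refl p q = pos-cong v refl p q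

restrictPerm : ∀ {m n} (σ : Permutation m n) (w : Vec Bool m) (w' : Vec Bool n) →
               (∀ j → lookup w' j ≡ lookup w (σ ⟨$⟩ˡ j)) →
               Permutation ∣ w ∣ₛ ∣ w' ∣ₛ
restrictPerm σ w w' h = permutation to from invˡ invʳ
  where
  p₁ : ∀ i → lookup w' (σ ⟨$⟩ʳ elt w i) ≡ true
  p₁ i = trans (h _) (trans (cong (lookup w) (inverseˡ σ)) (elt-true w i))
  p₂ : ∀ j → lookup w (σ ⟨$⟩ˡ elt w' j) ≡ true
  p₂ j = trans (sym (h (elt w' j))) (elt-true w' j)
  to : Fin ∣ w ∣ₛ → Fin ∣ w' ∣ₛ
  to i = pos w' (σ ⟨$⟩ʳ elt w i) (p₁ i)
  from : Fin ∣ w' ∣ₛ → Fin ∣ w ∣ₛ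
  from j = pos w (σ ⟨$⟩ˡ elt w' j) (p₂ j)
  invˡ : ∀ j → to (from j) ≡ j
  invˡ j = trans (pos-cong w' (trans (cong (σ ⟨$⟩ʳ_) (elt-pos w _ (p₂ j))) (inverseʳ σ))
                   (p₁ (from j)) (elt-true w' j))
                 (pos-elt w' j (elt-true w' j))
  invʳ : ∀ i → from (to i) ≡ i
  invʳ i = trans (pos-cong w (trans (cong (σ ⟨$⟩ˡ_) (elt-pos w' _ (p₁ i))) (inverseˡ σ))
                   (p₂ (to i)) (elt-true w i))
                 (pos-elt w i (elt-true w i))

image : ∀ {m n} → Permutation m n → Vec Bool m → Vec Bool n
image σ v = tabulate (λ j → lookup v (σ ⟨$⟩ˡ j))

compl : ∀ {n} → Vec Bool n → Vec Bool n
compl = map not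

image-spec : ∀ {m n} (σ : Permutation m n) (v : Vec Bool m) j →
             lookup (image σ v) j ≡ lookup v (σ ⟨$⟩ˡ j)
image-spec σ v j = lookup∘tabulate _ j

image-compl-spec : ∀ {m n} (σ : Permutation m n) (v : Vec Bool m) j →
                   lookup (compl (image σ v)) j ≡ lookup (compl v) (σ ⟨$⟩ˡ j)
image-compl-spec σ v j =
  trans (lookup-map j not (image σ v))
        (trans (cong not (image-spec σ v j)) (sym (lookup-map (σ ⟨$⟩ˡ j) not v)))

sumSub : ∀ n → (Vec Bool n → ℕ) → ℕ
sumSub zero f = f []
sumSub (suc n) f = sumSub n (λ v → f (false ∷ v)) + sumSub n (λ v → f (true ∷ v))

decSub : ∀ n (f : Vec Bool n → ℕ) → Fin (sumSub n f) → Σ (Vec Bool n) (λ v → Fin (f v))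
decSub zero f i = [] , i
decSub (suc n) f i with splitAt (sumSub n (λ v → f (false ∷ v))) i
... | inj₁ j = let r = decSub n (λ v → f (false ∷ v)) j in (false ∷ proj₁ r) , proj₂ r
... | inj₂ j = let r = decSub n (λ v → f (true ∷ v)) j in (true ∷ proj₁ r) , proj₂ r

encSub : ∀ n (f : Vec Bool n → ℕ) → Σ (Vec Bool n) (λ v → Fin (f v)) → Fin (sumSub n f)
encSub zero f ([] , i) = i
encSub (suc n) f (false ∷ v , i) =
  encSub n (λ v → f (false ∷ v)) (v , i) ↑ˡ sumSub n (λ v → f (true ∷ v))
encSub (suc n) f (true ∷ v , i) =
  sumSub n (λ v → f (false ∷ v)) ↑ʳ encSub n (λ v → f (true ∷ v)) (v , i)

-- (F · G)[U] = Σ_{V ⊆ U} F[V] × G[U ∖ V]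
_·ₛ_ : Species → Species → Species
card (F ·ₛ G) n = sumSub n (λ v → card F ∣ v ∣ₛ * card G ∣ compl v ∣ₛ)
act (F ·ₛ G) {m} {n} σ x with decSub m (λ v → card F ∣ v ∣ₛ * card G ∣ compl v ∣ₛ) x
... | v , xy with remQuot (card G ∣ compl v ∣ₛ) xy
... | a , b =
  encSub n (λ v → card F ∣ v ∣ₛ * card G ∣ compl v ∣ₛ)
    ( image σ v
    , combine (act F (restrictPerm σ v (image σ v) (image-spec σ v)) a)
              (act G (restrictPerm σ (compl v) (compl (image σ v)) (image-compl-spec σ v)) b))

-- F'[U] = F[U ⊔ {*}]  (the new point * is 0 in Fin (suc n))
deriv : Species → Species
card (deriv F) n = card F (suc n)
act (deriv F) σ = act F (lift₀ σ)

-- X[U] = U if |U| = 1, else ∅  (encoded as Fin 1 / Fin 0)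
cardX : ℕ → ℕ
cardX (suc zero) = 1
cardX _ = 0

actX : ∀ {m n} → Permutation m n → Fin (cardX m) → Fin (cardX n)
actX {suc zero} σ x with ↔⇒≡ σ
... | refl = x

Xₛ : Species
card Xₛ = cardX
act Xₛ = actX

cardOne : ℕ → ℕ
cardOne zero = 1
cardOne (suc _) = 0

actOne : ∀ {m n} → Permutation m n → Fin (cardOne m) → Fin (cardOne n)
actOne {zero} σ x with ↔⇒≡ σ
... | refl = x

Oneₛ : Species
card Oneₛ = cardOne
act Oneₛ = actOne

-- An element Φ of ℚVir is represented by, for each
-- cardinality n, a finite list of pairs (c , F) of a rational
-- coefficient and a species F concentrated in cardinality n; it stands
-- for the summable formal sum  Φ = Σ_n Σ_{(c,F) ∈ Φ n} c · F .
-- (Decomposing each F into molecular species gives the molecular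
-- expansion; every element of ℚVir arises this way.)

ℚVir : Set
ℚVir = ℕ → List (ℚ × Species)

Homogeneous : ℕ → Species → Set
Homogeneous n F = ∀ m → m ≢ n → card F m ≡ 0

WellFormed : ℚVir → Set
WellFormed Φ = ∀ n → All (λ cF → IsSpecies (proj₂ cF) × Homogeneous n (proj₂ cF)) (Φ n)

0ⱽ : ℚVir
0ⱽ n = []

1ⱽ : ℚVir
1ⱽ zero = (1ℚ , Oneₛ) ∷ []
1ⱽ (suc n) = []

𝕏 : ℚVir
𝕏 (suc zero) = (1ℚ , Xₛ) ∷ []
𝕏 _ = []

_+ⱽ_ : ℚVir → ℚVir → ℚVir
(Φ +ⱽ Ψ) n = Φ n ++ Ψ n

_•ⱽ_ : ℚ → ℚVir → ℚVir
(c •ⱽ Φ) n = L.map (λ cF → (c Q.* proj₁ cF , proj₂ cF)) (Φ n)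

_*ⱽ_ : ℚVir → ℚVir → ℚVir
(Φ *ⱽ Ψ) n =
  concatMap (λ a →
    concatMap (λ cF →
      L.map (λ dG → (proj₁ cF Q.* proj₁ dG , proj₂ cF ·ₛ proj₂ dG))
            (Ψ (n ∸ a)))
      (Φ a))
    (upTo (suc n))

∂ⱽ : ℚVir → ℚVir
∂ⱽ Φ n = L.map (λ cF → (proj₁ cF , deriv (proj₂ cF))) (Φ (suc n))

iter : {A : Set} → ℕ → (A → A) → A → A
iter zero f x = x
iter (suc k) f x = f (iter k f x)

∂ⱽ^ : ℕ → ℚVir → ℚVir
∂ⱽ^ k = iter k ∂ⱽ

𝕏^ : ℕ → ℚVir
𝕏^ i = iter i (𝕏 *ⱽ_) 1ⱽ

-- (-1)^(i-1) / i!  for i = suc k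
joyalCoeff : ℕ → ℚ
joyalCoeff k = sgn k / (suc k !)
  where
  instance _ = suc k !≢0
  sgn : ℕ → ℤ
  sgn zero = + 1
  sgn (suc zero) = -[1+ 0 ]
  sgn (suc (suc j)) = sgn j

-- Joyal integral ∫_{e^X} Φ = Σ_{i≥1} (-1)^(i-1) X^i/i! Φ^(i-1).
-- The sum is summable: the term with index i has no component of
-- cardinality < i, so the cardinality-n component only involves
-- i = 1, …, n.
∫ⱽ : ℚVir → ℚVir
∫ⱽ Φ n = concatMap (λ k → (joyalCoeff k •ⱽ (𝕏^ (suc k) *ⱽ ∂ⱽ^ k Φ)) n) (upTo n)

-- Formal power series over ℚ, as coefficient sequences (coefficient
-- of x^n).

Series : Set
Series = ℕ → ℚ

_≗ˢ_ : Series → Series → Set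
f ≗ˢ g = ∀ n → f n ≡ g n

0ˢ : Series
0ˢ n = 0ℚ

1ˢ : Series
1ˢ zero = 1ℚ
1ˢ (suc n) = 0ℚ

_+ˢ_ : Series → Series → Series
(f +ˢ g) n = f n Q.+ g n

_*ˢ_ : Series → Series → Series
(f *ˢ g) n = L.foldr Q._+_ 0ℚ (L.map (λ a → f a Q.* g (n ∸ a)) (upTo (suc n)))

dˢ : Series → Series
dˢ f n = (+ suc n / 1) Q.* f (suc n)

∫ˢ : Series → Series
∫ˢ f zero = 0ℚ
∫ˢ f (suc n) = (+ 1 / suc n) Q.* f n

gen : ℚVir → Series
gen Φ n = L.foldr Q._+_ 0ℚ
  (L.map (λ cF → proj₁ cF Q.* ((+ card (proj₂ cF) n) / (n !))) (Φ n))
  where instance _ = n !≢0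

{-# OPTIONS --safe #-}

-- A summand c·F of Φ whose species F is concentrated in cardinality n
-- contributes c·|F[n]|/n! to the coefficient of xⁿ, so every identity can be
-- checked coefficientwise on homogeneous summands.  For F
-- and G concentrated in cardinalities a and b, a structure of F·G on an
-- (a+b)-set is an a-subset with an F-structure on it and a G-structure on its
-- complement, so |(F·G)[a+b]| = C(a+b,a)·|F[a]|·|G[b]|; dividing by (a+b)!
-- gives the Cauchy product.  Since F'[n] = F[n+1], the weight 1/n! becomes
-- (n+1)/(n+1)!, which is d/dx.  Finally X^i has series xⁱ, so the coefficient
-- of x^(n+1) in ∫_{e^X} Φ is φₙ times
--   Σ_{k≤n} (-1)^k/(k+1)! · n!/(n-k)!  =  1/(n+1) · Σ_{k≤n} (-1)^k C(n+1,k+1),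
-- and the alternating sum telescopes to 1 by Pascal's rule.

module Submission where

open import Level using (Level)
open import Function using (_∘_; id)
open import Data.List using (List; []; _∷_; _++_; map; foldr; concatMap; upTo; applyUpTo)
open import Algebra.Bundles using (Semiring; Ring)

module ListSum {c ℓ} (R : Semiring c ℓ) where
  open Semiring R
  open import Relation.Binary.Reasoning.Setoid setoid

  private variable
    a b : Level
    A : Set a
    B : Set b

  sum : List Carrier → Carrier
  sum = foldr _+_ 0#

  sum-map-++ : ∀ (f : A → Carrier) xs ys →
               sum (map f (xs ++ ys)) ≈ sum (map f xs) + sum (map f ys)
  sum-map-++ f []       ys = sym (+-identityˡ _)
  sum-map-++ f (x ∷ xs) ys = begin
    f x + sum (map f (xs ++ ys))            ≈⟨ +-congˡ (sum-map-++ f xs ys) ⟩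
    f x + (sum (map f xs) + sum (map f ys)) ≈⟨ +-assoc _ _ _ ⟨
    f x + sum (map f xs) + sum (map f ys)   ∎

  sum-map-concatMap : ∀ (f : B → Carrier) (g : A → List B) xs →
                      sum (map f (concatMap g xs)) ≈ sum (map (sum ∘ map f ∘ g) xs)
  sum-map-concatMap f g []       = refl
  sum-map-concatMap f g (x ∷ xs) =
    trans (sum-map-++ f (g x) (concatMap g xs)) (+-congˡ (sum-map-concatMap f g xs))

  *-distribˡ-sum : ∀ x (f : A → Carrier) ys → x * sum (map f ys) ≈ sum (map (λ y → x * f y) ys)
  *-distribˡ-sum x f []       = zeroʳ x
  *-distribˡ-sum x f (y ∷ ys) = trans (distribˡ x (f y) _) (+-congˡ (*-distribˡ-sum x f ys))

  *-distribʳ-sum : ∀ x (f : A → Carrier) ys → sum (map f ys) * x ≈ sum (map (λ y → f y * x) ys)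
  *-distribʳ-sum x f []       = zeroˡ x
  *-distribʳ-sum x f (y ∷ ys) = trans (distribʳ x (f y) _) (+-congˡ (*-distribʳ-sum x f ys))

open import Defs
open import Data.Bool using (Bool; true; false)
open import Data.Vec using (Vec; []; _∷_)
open import Data.Product using (_×_; _,_; proj₁; proj₂)
open import Data.Nat as ℕ using (ℕ; zero; suc; _+_; _*_; _∸_; _!; _≤_; _≟_; NonZero; z≤n; s≤s)
open import Data.Nat.Properties
  using (_!≢0; _!*_!≢0; +-comm; +-suc; *-assoc; *-identityˡ; *-identityʳ; *-distribˡ-+; m≤m+n; m+n∸m≡n; m+[n∸m]≡n;
         ≤-pred; n<1+n)
open import Data.Nat.DivMod using (m/n*n≡m)
open import Data.Nat.Combinatorics
  using (_C_; nCk≡n!/k![n-k]!; k![n∸k]!∣n!; k>n⇒nCk≡0; nCk+nC[k+1]≡[n+1]C[k+1])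
open import Data.Nat.Tactic.RingSolver using (solve-∀)
open import Data.Integer as ℤ using (ℤ; +_; -[1+_])
import Data.Integer.Properties as ℤ
open import Data.Rational as ℚ using (ℚ; _/_; 0ℚ; 1ℚ; normalize; fromℚᵘ)
import Data.Rational.Properties as ℚ
open import Data.Rational.Unnormalised as ℚᵘ using (mkℚᵘ; *≡*)
import Data.Rational.Unnormalised.Properties as ℚᵘ
open import Data.List.Properties using (map-cong; map-cong-local; map-∘; map-upTo)
open import Data.List.Relation.Unary.All as All using (All; []; _∷_)
open import Data.List.Relation.Unary.All.Properties using (map⁺; concat⁺; applyUpTo⁺₁)
import Tactic.RingSolver as RingSolver
import Tactic.RingSolver.Core.AlmostCommutativeRing as ACR
open import Relation.Nullary using (yes; no)
open import Relation.Nullary.Decidable using (dec⇒maybe)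
open import Relation.Nullary.Negation using (contradiction)

open ListSum (Ring.semiring ℚ.+-*-ring)

open import Relation.Binary.PropositionalEquality
open ≡-Reasoning

ℚ-ring : ACR.AlmostCommutativeRing _ _
ℚ-ring = ACR.fromCommutativeRing ℚ.+-*-commutativeRing (λ q → dec⇒maybe (0ℚ ℚ.≟ q))

fromℕ : ℕ → ℚ
fromℕ n = + n / 1

infixl 7 _/!_

_/!_ : ℕ → ℕ → ℚ
m /! n = normalize m (n !) {{n !≢0}}

fromℚᵘ-homo-+ : ∀ p q → fromℚᵘ (p ℚᵘ.+ q) ≡ fromℚᵘ p ℚ.+ fromℚᵘ q
fromℚᵘ-homo-+ p q = ℚ.toℚᵘ-injective (ℚᵘ.≃-trans (ℚ.toℚᵘ-fromℚᵘ (p ℚᵘ.+ q)) (ℚᵘ.≃-sym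
  (ℚᵘ.≃-trans (ℚ.toℚᵘ-homo-+ (fromℚᵘ p) (fromℚᵘ q)) (ℚᵘ.+-cong (ℚ.toℚᵘ-fromℚᵘ p) (ℚ.toℚᵘ-fromℚᵘ q)))))

fromℚᵘ-homo-* : ∀ p q → fromℚᵘ (p ℚᵘ.* q) ≡ fromℚᵘ p ℚ.* fromℚᵘ q
fromℚᵘ-homo-* p q = ℚ.toℚᵘ-injective (ℚᵘ.≃-trans (ℚ.toℚᵘ-fromℚᵘ (p ℚᵘ.* q)) (ℚᵘ.≃-sym
  (ℚᵘ.≃-trans (ℚ.toℚᵘ-homo-* (fromℚᵘ p) (fromℚᵘ q)) (ℚᵘ.*-cong (ℚ.toℚᵘ-fromℚᵘ p) (ℚ.toℚᵘ-fromℚᵘ q)))))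

fromℕ-+ : ∀ m n → fromℕ (m + n) ≡ fromℕ m ℚ.+ fromℕ n
fromℕ-+ m n = trans (cong (λ i → fromℚᵘ (mkℚᵘ i 0)) numerator)
                    (fromℚᵘ-homo-+ (mkℚᵘ (+ m) 0) (mkℚᵘ (+ n) 0))
  where
  numerator : + (m + n) ≡ + m ℤ.* + 1 ℤ.+ + n ℤ.* + 1
  numerator = trans (ℤ.pos-+ m n) (sym (cong₂ ℤ._+_ (ℤ.*-identityʳ (+ m)) (ℤ.*-identityʳ (+ n))))

-- For c = suc c′, normalize m c unfolds to fromℚᵘ (mkℚᵘ (+ m) c′).
normalize-cross : ∀ m c n d .{{_ : NonZero c}} .{{_ : NonZero d}} →
                  m * d ≡ n * c → normalize m c ≡ normalize n d
normalize-cross m (suc c) n (suc d) eq = ℚ.fromℚᵘ-cong {mkℚᵘ (+ m) c} {mkℚᵘ (+ n) d} (*≡* (begin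
  + m ℤ.* + suc d ≡⟨ ℤ.pos-* m (suc d) ⟨
  + (m * suc d)   ≡⟨ cong +_ eq ⟩
  + (n * suc c)   ≡⟨ ℤ.pos-* n (suc c) ⟩
  + n ℤ.* + suc c ∎))

normalize-*-cross : ∀ m c n d p e .{{_ : NonZero c}} .{{_ : NonZero d}} .{{_ : NonZero e}} →
                    m * n * e ≡ p * (c * d) → normalize m c ℚ.* normalize n d ≡ normalize p e
normalize-*-cross m (suc c) n (suc d) p e eq = begin
  fromℚᵘ (mkℚᵘ (+ m) c) ℚ.* fromℚᵘ (mkℚᵘ (+ n) d) ≡⟨ fromℚᵘ-homo-* (mkℚᵘ (+ m) c) (mkℚᵘ (+ n) d) ⟨
  (+ m ℤ.* + n) / (suc c * suc d)                   ≡⟨ cong (λ i → i / (suc c * suc d)) (ℤ.pos-* m n) ⟨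
  normalize (m * n) (suc c * suc d)                  ≡⟨ normalize-cross (m * n) (suc c * suc d) p e eq ⟩
  normalize p e                                      ∎

/!-suc : ∀ m n → fromℕ (suc n) ℚ.* (m /! suc n) ≡ m /! n
/!-suc m n = normalize-*-cross (suc n) 1 m (suc n !) m (n !) {{_}} {{suc n !≢0}} {{n !≢0}}
  (cross (n !) m n)
  where
  cross : ∀ f m n → (1 + n) * m * f ≡ m * (1 * ((1 + n) * f))
  cross = solve-∀

/!-self : ∀ n → n ! /! n ≡ 1ℚ
/!-self n = normalize-cross (n !) (n !) 1 1 {{n !≢0}} (trans (*-identityʳ (n !)) (sym (*-identityˡ (n !))))

nCk*[k!*[n∸k]!]≡n! : ∀ {n k} → k ≤ n → (n C k) * (k ! * (n ∸ k) !) ≡ n !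
nCk*[k!*[n∸k]!]≡n! {n} {k} k≤n = begin
  (n C k) * (k ! * (n ∸ k) !)                   ≡⟨ cong (_* (k ! * (n ∸ k) !)) (nCk≡n!/k![n-k]! k≤n) ⟩
  n ! ℕ./ (k ! * (n ∸ k) !) * (k ! * (n ∸ k) !) ≡⟨ m/n*n≡m (k![n∸k]!∣n! k≤n) ⟩
  n !                                           ∎
  where
  instance _ = k !* (n ∸ k) !≢0

[m+n]Cm*[m!*n!]≡[m+n]! : ∀ m n → ((m + n) C m) * (m ! * n !) ≡ (m + n) !
[m+n]Cm*[m!*n!]≡[m+n]! m n =
  subst (λ k → ((m + n) C m) * (m ! * k !) ≡ (m + n) !) (m+n∸m≡n m n) (nCk*[k!*[n∸k]!]≡n! (m≤m+n m n))

/!-* : ∀ x y a b → (x /! a) ℚ.* (y /! b) ≡ (x * y * ((a + b) C a)) /! (a + b)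
/!-* x y a b =
  normalize-*-cross x (a !) y (b !) (x * y * ((a + b) C a)) ((a + b) !) {{a !≢0}} {{b !≢0}} {{(a + b) !≢0}} (begin
    x * y * (a + b) !                     ≡⟨ cong (x * y *_) ([m+n]Cm*[m!*n!]≡[m+n]! a b) ⟨
    x * y * (((a + b) C a) * (a ! * b !)) ≡⟨ assoc (x * y) ((a + b) C a) (a ! * b !) ⟩
    x * y * ((a + b) C a) * (a ! * b !)   ∎)
  where
  assoc : ∀ p q r → p * (q * r) ≡ p * q * r
  assoc = solve-∀

δ : ℕ → ℕ → ℕ
δ zero    zero    = 1
δ zero    (suc n) = 0
δ (suc m) zero    = 0
δ (suc m) (suc n) = δ m n

δ-refl : ∀ n → δ n n ≡ 1
δ-refl zero    = refl
δ-refl (suc n) = δ-refl n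

δ-≢ : ∀ {m n} → m ≢ n → δ m n ≡ 0
δ-≢ {zero}  {zero}  0≢0 = contradiction refl 0≢0
δ-≢ {zero}  {suc n} _   = refl
δ-≢ {suc m} {zero}  _   = refl
δ-≢ {suc m} {suc n} m≢n = δ-≢ (m≢n ∘ cong suc)

δ*δ≡δ*δ[+] : ∀ a b x y → δ a x * δ b y ≡ δ a x * δ (a + b) (x + y)
δ*δ≡δ*δ[+] zero    b zero    y = refl
δ*δ≡δ*δ[+] zero    b (suc x) y = refl
δ*δ≡δ*δ[+] (suc a) b zero    y = refl
δ*δ≡δ*δ[+] (suc a) b (suc x) y = δ*δ≡δ*δ[+] a b x y

sumSub-cong : ∀ n {f g : Vec Bool n → ℕ} → (∀ v → f v ≡ g v) → sumSub n f ≡ sumSub n g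
sumSub-cong zero    f≗g = f≗g []
sumSub-cong (suc n) f≗g = cong₂ _+_ (sumSub-cong n (f≗g ∘ (false ∷_))) (sumSub-cong n (f≗g ∘ (true ∷_)))

sumSub-*ˡ : ∀ n c (f : Vec Bool n → ℕ) → sumSub n (λ v → c * f v) ≡ c * sumSub n f
sumSub-*ˡ zero    c f = refl
sumSub-*ˡ (suc n) c f = trans (cong₂ _+_ (sumSub-*ˡ n c (f ∘ (false ∷_))) (sumSub-*ˡ n c (f ∘ (true ∷_))))
                              (sym (*-distribˡ-+ c _ _))

∣v∣+∣compl-v∣≡n : ∀ {n} (v : Vec Bool n) → ∣ v ∣ₛ + ∣ compl v ∣ₛ ≡ n
∣v∣+∣compl-v∣≡n []          = refl
∣v∣+∣compl-v∣≡n (true ∷ v)  = cong suc (∣v∣+∣compl-v∣≡n v)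
∣v∣+∣compl-v∣≡n (false ∷ v) = trans (+-suc ∣ v ∣ₛ _) (cong suc (∣v∣+∣compl-v∣≡n v))

sumSub-δ∣v∣≡nCa : ∀ n a → sumSub n (λ v → δ a ∣ v ∣ₛ) ≡ n C a
sumSub-δ∣v∣≡nCa zero    zero    = refl
sumSub-δ∣v∣≡nCa zero    (suc a) = refl
sumSub-δ∣v∣≡nCa (suc n) zero    = cong₂ _+_ (sumSub-δ∣v∣≡nCa n 0) (sumSub-*ˡ n 0 (λ _ → 0))
sumSub-δ∣v∣≡nCa (suc n) (suc a) = begin
  sumSub n (λ v → δ (suc a) ∣ v ∣ₛ) + sumSub n (λ v → δ a ∣ v ∣ₛ)
    ≡⟨ cong₂ _+_ (sumSub-δ∣v∣≡nCa n (suc a)) (sumSub-δ∣v∣≡nCa n a) ⟩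
  n C suc a + n C a    ≡⟨ +-comm (n C suc a) (n C a) ⟩
  n C a + n C suc a    ≡⟨ nCk+nC[k+1]≡[n+1]C[k+1] n a ⟩
  suc n C suc a        ∎

homogeneous⇒δ : ∀ {n F} → Homogeneous n F → ∀ m → card F m ≡ δ n m * card F n
homogeneous⇒δ {n} {F} hF m with m ≟ n
... | yes refl = sym (trans (cong (_* card F m) (δ-refl m)) (*-identityˡ (card F m)))
... | no  m≢n  = trans (hF m m≢n) (cong (_* card F n) (sym (δ-≢ (m≢n ∘ sym))))

card-·ₛ : ∀ {a b F G} → Homogeneous a F → Homogeneous b G → ∀ m →
          card (F ·ₛ G) m ≡ δ (a + b) m * (card F a * card G b) * (m C a)
card-·ₛ {a} {b} {F} {G} hF hG m = begin
  sumSub m (λ v → card F ∣ v ∣ₛ * card G ∣ compl v ∣ₛ) ≡⟨ sumSub-cong m split ⟩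
  sumSub m (λ v → δ (a + b) m * K * δ a ∣ v ∣ₛ)       ≡⟨ sumSub-*ˡ m (δ (a + b) m * K) _ ⟩
  δ (a + b) m * K * sumSub m (λ v → δ a ∣ v ∣ₛ)       ≡⟨ cong (δ (a + b) m * K *_) (sumSub-δ∣v∣≡nCa m a) ⟩
  δ (a + b) m * K * (m C a)                            ∎
  where
  K = card F a * card G b
  interchange : ∀ w x y z → w * x * (y * z) ≡ w * y * (x * z)
  interchange = solve-∀
  rotate : ∀ x y z → x * y * z ≡ y * z * x
  rotate = solve-∀
  split : ∀ v → card F ∣ v ∣ₛ * card G ∣ compl v ∣ₛ ≡ δ (a + b) m * K * δ a ∣ v ∣ₛ
  split v = begin
    card F ∣ v ∣ₛ * card G ∣ compl v ∣ₛ
      ≡⟨ cong₂ _*_ (homogeneous⇒δ {F = F} hF ∣ v ∣ₛ) (homogeneous⇒δ {F = G} hG ∣ compl v ∣ₛ) ⟩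
    δ a ∣ v ∣ₛ * card F a * (δ b ∣ compl v ∣ₛ * card G b)
      ≡⟨ interchange (δ a ∣ v ∣ₛ) (card F a) (δ b ∣ compl v ∣ₛ) (card G b) ⟩
    δ a ∣ v ∣ₛ * δ b ∣ compl v ∣ₛ * K
      ≡⟨ cong (_* K) (δ*δ≡δ*δ[+] a b ∣ v ∣ₛ ∣ compl v ∣ₛ) ⟩
    δ a ∣ v ∣ₛ * δ (a + b) (∣ v ∣ₛ + ∣ compl v ∣ₛ) * K
      ≡⟨ cong (λ n → δ a ∣ v ∣ₛ * δ (a + b) n * K) (∣v∣+∣compl-v∣≡n v) ⟩
    δ a ∣ v ∣ₛ * δ (a + b) m * K
      ≡⟨ rotate (δ a ∣ v ∣ₛ) (δ (a + b) m) K ⟩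
    δ (a + b) m * K * δ a ∣ v ∣ₛ
      ∎

homogeneous-·ₛ : ∀ {a b n F G} → a + b ≡ n → Homogeneous a F → Homogeneous b G → Homogeneous n (F ·ₛ G)
homogeneous-·ₛ {a} {b} {F = F} {G} refl hF hG m m≢a+b =
  trans (card-·ₛ {F = F} {G} hF hG m) (cong (λ d → d * (card F a * card G b) * (m C a)) (δ-≢ (m≢a+b ∘ sym)))

card-·ₛ[a+b] : ∀ {a b F G} → Homogeneous a F → Homogeneous b G →
                card (F ·ₛ G) (a + b) ≡ card F a * card G b * ((a + b) C a)
card-·ₛ[a+b] {a} {b} {F} {G} hF hG = trans (card-·ₛ {F = F} {G} hF hG (a + b))
  (cong (_* ((a + b) C a)) (trans (cong (_* K) (δ-refl (a + b))) (*-identityˡ K)))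
  where K = card F a * card G b

homogeneous-deriv : ∀ {n F} → Homogeneous (suc n) F → Homogeneous n (deriv F)
homogeneous-deriv hF m m≢n = hF (suc m) (m≢n ∘ cong ℕ.pred)

homogeneous-One : Homogeneous 0 Oneₛ
homogeneous-One zero    0≢0 = contradiction refl 0≢0
homogeneous-One (suc m) _   = refl

homogeneous-X : Homogeneous 1 Xₛ
homogeneous-X zero          _   = refl
homogeneous-X (suc zero)    1≢1 = contradiction refl 1≢1
homogeneous-X (suc (suc m)) _   = refl

Graded : ℚVir → Set
Graded Φ = ∀ n → All (Homogeneous n ∘ proj₂) (Φ n)

wellFormed⇒graded : ∀ {Φ} → WellFormed Φ → Graded Φ
wellFormed⇒graded wf n = All.map proj₂ (wf n)

_⊗_ : ℚ × Species → ℚ × Species → ℚ × Species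
cF ⊗ dG = proj₁ cF ℚ.* proj₁ dG , proj₂ cF ·ₛ proj₂ dG

graded-1ⱽ : Graded 1ⱽ
graded-1ⱽ zero    = homogeneous-One ∷ []
graded-1ⱽ (suc n) = []

graded-𝕏 : Graded 𝕏
graded-𝕏 zero          = []
graded-𝕏 (suc zero)    = homogeneous-X ∷ []
graded-𝕏 (suc (suc n)) = []

graded-*ⱽ : ∀ {Φ Ψ} → Graded Φ → Graded Ψ → Graded (Φ *ⱽ Ψ)
graded-*ⱽ {Φ} {Ψ} gΦ gΨ n = concat⁺ (map⁺ (applyUpTo⁺₁ id (suc n) λ a<1+n →
  concat⁺ (map⁺ (All.map (λ {cF} → products (m+[n∸m]≡n (≤-pred a<1+n)) {cF}) (gΦ _)))))
  where
  products : ∀ {a b} → a + b ≡ n → ∀ {cF} → Homogeneous a (proj₂ cF) →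
             All (Homogeneous n ∘ proj₂) (map (cF ⊗_) (Ψ b))
  products a+b≡n {cF} hF =
    map⁺ (All.map (λ {dG} → homogeneous-·ₛ {F = proj₂ cF} {G = proj₂ dG} a+b≡n hF) (gΨ _))

graded-∂ⱽ : ∀ {Φ} → Graded Φ → Graded (∂ⱽ Φ)
graded-∂ⱽ gΦ n = map⁺ (All.map (λ {cF} → homogeneous-deriv {F = proj₂ cF}) (gΦ (suc n)))

graded-∂ⱽ^ : ∀ k {Φ} → Graded Φ → Graded (∂ⱽ^ k Φ)
graded-∂ⱽ^ zero    gΦ = gΦ
graded-∂ⱽ^ (suc k) gΦ = graded-∂ⱽ (graded-∂ⱽ^ k gΦ)

graded-𝕏^ : ∀ j → Graded (𝕏^ j)
graded-𝕏^ zero    = graded-1ⱽ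
graded-𝕏^ (suc j) = graded-*ⱽ graded-𝕏 (graded-𝕏^ j)

xˢ^ : ℕ → Series
xˢ^ j n = fromℕ (δ j n)

*ˢ-congʳ : ∀ {f g} h → f ≗ˢ g → (f *ˢ h) ≗ˢ (g *ˢ h)
*ˢ-congʳ h f≗g n = cong sum (map-cong (λ a → cong (ℚ._* h (n ∸ a)) (f≗g a)) (upTo (suc n)))

sum-δ : ∀ j n (g : ℕ → ℚ) → j ≤ n → sum (applyUpTo (λ a → xˢ^ j a ℚ.* g a) (suc n)) ≡ g j
sum-δ zero n g _ = begin
  1ℚ ℚ.* g 0 ℚ.+ sum (applyUpTo (λ a → 0ℚ ℚ.* g (suc a)) n)
    ≡⟨ cong₂ ℚ._+_ (ℚ.*-identityˡ (g 0)) (sum-0* (g ∘ suc) n) ⟩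
  g 0 ℚ.+ 0ℚ
    ≡⟨ ℚ.+-identityʳ (g 0) ⟩
  g 0 ∎
  where
  sum-0* : ∀ (h : ℕ → ℚ) n → sum (applyUpTo (λ a → 0ℚ ℚ.* h a) n) ≡ 0ℚ
  sum-0* h zero    = refl
  sum-0* h (suc n) = cong₂ ℚ._+_ (ℚ.*-zeroˡ (h 0)) (sum-0* (h ∘ suc) n)
sum-δ (suc j) (suc n) g (s≤s j≤n) = begin
  0ℚ ℚ.* g 0 ℚ.+ sum (applyUpTo (λ a → xˢ^ j a ℚ.* g (suc a)) (suc n))
    ≡⟨ cong₂ ℚ._+_ (ℚ.*-zeroˡ (g 0)) (sum-δ j n (g ∘ suc) j≤n) ⟩
  0ℚ ℚ.+ g (suc j)
    ≡⟨ ℚ.+-identityˡ (g (suc j)) ⟩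
  g (suc j) ∎

xˢ^-*ˢ : ∀ {j n} f → j ≤ n → (xˢ^ j *ˢ f) n ≡ f (n ∸ j)
xˢ^-*ˢ {j} {n} f j≤n = trans (cong sum (map-upTo (λ a → xˢ^ j a ℚ.* f (n ∸ a)) (suc n)))
                             (sum-δ j n (λ a → f (n ∸ a)) j≤n)

-- gen Φ n is definitionally sum (map (coeff n) (Φ n)).
coeff : ℕ → ℚ × Species → ℚ
coeff n cF = proj₁ cF ℚ.* (card (proj₂ cF) n /! n)

gen-+ⱽ : ∀ Φ Ψ → gen (Φ +ⱽ Ψ) ≗ˢ (gen Φ +ˢ gen Ψ)
gen-+ⱽ Φ Ψ n = sum-map-++ (coeff n) (Φ n) (Ψ n)

gen-•ⱽ : ∀ c Φ n → gen (c •ⱽ Φ) n ≡ c ℚ.* gen Φ n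
gen-•ⱽ c Φ n = begin
  sum (map (coeff n) (map (λ cF → (c ℚ.* proj₁ cF , proj₂ cF)) (Φ n)))
    ≡⟨ cong sum (map-∘ (Φ n)) ⟨
  sum (map (λ cF → c ℚ.* proj₁ cF ℚ.* (card (proj₂ cF) n /! n)) (Φ n))
    ≡⟨ cong sum (map-cong (λ cF → ℚ.*-assoc c (proj₁ cF) _) (Φ n)) ⟩
  sum (map (λ cF → c ℚ.* coeff n cF) (Φ n))
    ≡⟨ *-distribˡ-sum c (coeff n) (Φ n) ⟨
  c ℚ.* gen Φ n ∎

coeff-⊗ : ∀ {a b n} cF dG → a + b ≡ n → Homogeneous a (proj₂ cF) → Homogeneous b (proj₂ dG) →
          coeff n (cF ⊗ dG) ≡ coeff a cF ℚ.* coeff b dG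
coeff-⊗ {a} {b} (c , F) (d , G) refl hF hG = begin
  c ℚ.* d ℚ.* (card (F ·ₛ G) (a + b) /! (a + b))
    ≡⟨ cong (λ N → c ℚ.* d ℚ.* (N /! (a + b))) (card-·ₛ[a+b] {F = F} {G} hF hG) ⟩
  c ℚ.* d ℚ.* (card F a * card G b * ((a + b) C a) /! (a + b))
    ≡⟨ cong (c ℚ.* d ℚ.*_) (/!-* (card F a) (card G b) a b) ⟨
  c ℚ.* d ℚ.* ((card F a /! a) ℚ.* (card G b /! b))
    ≡⟨ interchange c d (card F a /! a) (card G b /! b) ⟩
  c ℚ.* (card F a /! a) ℚ.* (d ℚ.* (card G b /! b)) ∎
  where
  interchange : ∀ w x y z → w ℚ.* x ℚ.* (y ℚ.* z) ≡ w ℚ.* y ℚ.* (x ℚ.* z)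
  interchange = RingSolver.solve-∀ ℚ-ring

sum-coeff-⊗ : ∀ {a b n} {xs ys} → a + b ≡ n →
              All (Homogeneous a ∘ proj₂) xs → All (Homogeneous b ∘ proj₂) ys →
              sum (map (coeff n) (concatMap (λ cF → map (cF ⊗_) ys) xs))
                ≡ sum (map (coeff a) xs) ℚ.* sum (map (coeff b) ys)
sum-coeff-⊗ {a} {b} {n} {xs} {ys} a+b≡n hxs hys = begin
  sum (map (coeff n) (concatMap (λ cF → map (cF ⊗_) ys) xs))
    ≡⟨ sum-map-concatMap (coeff n) (λ cF → map (cF ⊗_) ys) xs ⟩
  sum (map (λ cF → sum (map (coeff n) (map (cF ⊗_) ys))) xs)
    ≡⟨ cong sum (map-cong-local (All.map (λ {cF} → row cF) hxs)) ⟩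
  sum (map (λ cF → coeff a cF ℚ.* sum (map (coeff b) ys)) xs)
    ≡⟨ *-distribʳ-sum (sum (map (coeff b) ys)) (coeff a) xs ⟨
  sum (map (coeff a) xs) ℚ.* sum (map (coeff b) ys) ∎
  where
  row : ∀ cF → Homogeneous a (proj₂ cF) →
        sum (map (coeff n) (map (cF ⊗_) ys)) ≡ coeff a cF ℚ.* sum (map (coeff b) ys)
  row cF hF = begin
    sum (map (coeff n) (map (cF ⊗_) ys))
      ≡⟨ cong sum (map-∘ ys) ⟨
    sum (map (coeff n ∘ (cF ⊗_)) ys)
      ≡⟨ cong sum (map-cong-local (All.map (λ {dG} → coeff-⊗ cF dG a+b≡n hF) hys)) ⟩
    sum (map (λ dG → coeff a cF ℚ.* coeff b dG) ys)
      ≡⟨ *-distribˡ-sum (coeff a cF) (coeff b) ys ⟨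
    coeff a cF ℚ.* sum (map (coeff b) ys) ∎

gen-*ⱽ : ∀ {Φ Ψ} → Graded Φ → Graded Ψ → gen (Φ *ⱽ Ψ) ≗ˢ (gen Φ *ˢ gen Ψ)
gen-*ⱽ {Φ} {Ψ} gΦ gΨ n = trans
  (sum-map-concatMap (coeff n) (λ a → concatMap (λ cF → map (cF ⊗_) (Ψ (n ∸ a))) (Φ a)) (upTo (suc n)))
  (cong sum (map-cong-local (applyUpTo⁺₁ id (suc n) λ a<1+n →
    sum-coeff-⊗ (m+[n∸m]≡n (≤-pred a<1+n)) (gΦ _) (gΨ _))))

gen-∂ⱽ : ∀ Φ → gen (∂ⱽ Φ) ≗ˢ dˢ (gen Φ)
gen-∂ⱽ Φ n = begin
  sum (map (coeff n) (map (λ cF → (proj₁ cF , deriv (proj₂ cF))) (Φ (suc n))))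
    ≡⟨ cong sum (map-∘ (Φ (suc n))) ⟨
  sum (map (λ cF → proj₁ cF ℚ.* (card (proj₂ cF) (suc n) /! n)) (Φ (suc n)))
    ≡⟨ cong sum (map-cong (λ cF → coeff-deriv (proj₁ cF) (card (proj₂ cF) (suc n))) (Φ (suc n))) ⟩
  sum (map (λ cF → fromℕ (suc n) ℚ.* coeff (suc n) cF) (Φ (suc n)))
    ≡⟨ *-distribˡ-sum (fromℕ (suc n)) (coeff (suc n)) (Φ (suc n)) ⟨
  fromℕ (suc n) ℚ.* gen Φ (suc n) ∎
  where
  swap : ∀ x y z → x ℚ.* (y ℚ.* z) ≡ y ℚ.* (x ℚ.* z)
  swap = RingSolver.solve-∀ ℚ-ring
  coeff-deriv : ∀ c N → c ℚ.* (N /! n) ≡ fromℕ (suc n) ℚ.* (c ℚ.* (N /! suc n))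
  coeff-deriv c N = trans (cong (c ℚ.*_) (sym (/!-suc N n))) (swap c (fromℕ (suc n)) (N /! suc n))

gen-∂ⱽ^ : ∀ k Φ m → gen (∂ⱽ^ k Φ) m ≡ ((k + m) ! /! m) ℚ.* gen Φ (k + m)
gen-∂ⱽ^ zero    Φ m = sym (trans (cong (ℚ._* gen Φ m) (/!-self m)) (ℚ.*-identityˡ (gen Φ m)))
gen-∂ⱽ^ (suc k) Φ m = begin
  gen (∂ⱽ (∂ⱽ^ k Φ)) m
    ≡⟨ gen-∂ⱽ (∂ⱽ^ k Φ) m ⟩
  fromℕ (suc m) ℚ.* gen (∂ⱽ^ k Φ) (suc m)
    ≡⟨ cong (fromℕ (suc m) ℚ.*_) (gen-∂ⱽ^ k Φ (suc m)) ⟩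
  fromℕ (suc m) ℚ.* (((k + suc m) ! /! suc m) ℚ.* gen Φ (k + suc m))
    ≡⟨ ℚ.*-assoc (fromℕ (suc m)) ((k + suc m) ! /! suc m) (gen Φ (k + suc m)) ⟨
  fromℕ (suc m) ℚ.* ((k + suc m) ! /! suc m) ℚ.* gen Φ (k + suc m)
    ≡⟨ cong (ℚ._* gen Φ (k + suc m)) (/!-suc ((k + suc m) !) m) ⟩
  ((k + suc m) ! /! m) ℚ.* gen Φ (k + suc m)
    ≡⟨ cong (λ i → (i ! /! m) ℚ.* gen Φ i) (+-suc k m) ⟩
  ((suc k + m) ! /! m) ℚ.* gen Φ (suc k + m) ∎

gen-1ⱽ : gen 1ⱽ ≗ˢ 1ˢ
gen-1ⱽ zero    = refl
gen-1ⱽ (suc n) = refl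

gen-𝕏 : gen 𝕏 ≗ˢ xˢ^ 1
gen-𝕏 zero          = refl
gen-𝕏 (suc zero)    = refl
gen-𝕏 (suc (suc n)) = refl

gen-𝕏^ : ∀ j → gen (𝕏^ j) ≗ˢ xˢ^ j
gen-𝕏^ zero    zero    = refl
gen-𝕏^ zero    (suc n) = refl
gen-𝕏^ (suc j) n = begin
  gen (𝕏 *ⱽ 𝕏^ j) n              ≡⟨ gen-*ⱽ graded-𝕏 (graded-𝕏^ j) n ⟩
  (gen 𝕏 *ˢ gen (𝕏^ j)) n        ≡⟨ *ˢ-congʳ (gen (𝕏^ j)) gen-𝕏 n ⟩
  (xˢ^ 1 *ˢ gen (𝕏^ j)) n        ≡⟨ shift n ⟩
  xˢ^ (suc j) n                   ∎
  where
  shift : ∀ n → (xˢ^ 1 *ˢ gen (𝕏^ j)) n ≡ xˢ^ (suc j) n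
  shift zero    = cong (ℚ._+ 0ℚ) (ℚ.*-zeroˡ (gen (𝕏^ j) 0))
  shift (suc n) = trans (xˢ^-*ˢ (gen (𝕏^ j)) (s≤s z≤n)) (gen-𝕏^ j n)

gen-𝕏^*ⱽ : ∀ j {Φ n} → Graded Φ → j ≤ n → gen (𝕏^ j *ⱽ Φ) n ≡ gen Φ (n ∸ j)
gen-𝕏^*ⱽ j {Φ} {n} gΦ j≤n = begin
  gen (𝕏^ j *ⱽ Φ) n        ≡⟨ gen-*ⱽ (graded-𝕏^ j) gΦ n ⟩
  (gen (𝕏^ j) *ˢ gen Φ) n  ≡⟨ *ˢ-congʳ (gen Φ) (gen-𝕏^ j) n ⟩
  (xˢ^ j *ˢ gen Φ) n       ≡⟨ xˢ^-*ˢ (gen Φ) j≤n ⟩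
  gen Φ (n ∸ j)            ∎

sgn : ℕ → ℚ
sgn zero    = 1ℚ
sgn (suc k) = ℚ.- sgn k

sgnℤ : ℕ → ℤ
sgnℤ zero          = + 1
sgnℤ (suc zero)    = -[1+ 0 ]
sgnℤ (suc (suc k)) = sgnℤ k

sgnℤ-unique : (s : ℕ → ℕ → ℤ) → (∀ w → s w 0 ≡ + 1) → (∀ w → s w 1 ≡ -[1+ 0 ]) →
              (∀ w j → s w (suc (suc j)) ≡ s w j) → ∀ w j → s w j ≡ sgnℤ j
sgnℤ-unique s s₀ s₁ s₂ w zero          = s₀ w
sgnℤ-unique s s₀ s₁ s₂ w (suc zero)    = s₁ w
sgnℤ-unique s s₀ s₁ s₂ w (suc (suc j)) = trans (s₂ w j) (sgnℤ-unique s s₀ s₁ s₂ w j)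

sgnℤ-/ : ∀ k d .{{_ : NonZero d}} → sgnℤ k / d ≡ sgn k ℚ.* (+ 1 / d)
sgnℤ-/ zero          d = sym (ℚ.*-identityˡ (+ 1 / d))
sgnℤ-/ (suc zero)    d = trans (cong ℚ.-_ (sym (ℚ.*-identityˡ (+ 1 / d)))) (ℚ.neg-distribˡ-* 1ℚ (+ 1 / d))
sgnℤ-/ (suc (suc k)) d = trans (sgnℤ-/ k d) (cong (ℚ._* (+ 1 / d)) (sym (neg-involutive (sgn k))))
  where
  neg-involutive : ∀ x → ℚ.- ℚ.- x ≡ x
  neg-involutive = RingSolver.solve-∀ ℚ-ring

-- The sign inside joyalCoeff is local to its where block.  Abstracting its
-- parameter suc (suc j), and the non-injective _/_, lets unification solve
-- joyalSign as that function.
mutual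
  private
    joyalSign : ℕ → ℕ → ℤ
    joyalSign = _

  joyalCoeff≡sgnℤ/ : ∀ k → joyalCoeff k ≡ (sgnℤ k / suc k !) {{suc k !≢0}}
  joyalCoeff≡sgnℤ/ zero          = refl
  joyalCoeff≡sgnℤ/ (suc zero)    = refl
  joyalCoeff≡sgnℤ/ (suc (suc j)) with suc (suc j) | _/_
  ... | w | _÷_ = cong (λ i → (i ÷ _) {{suc (suc (suc j)) !≢0}})
                       (sgnℤ-unique joyalSign (λ _ → refl) (λ _ → refl) (λ _ _ → refl) w j)

joyalCoeff≡sgn*1/! : ∀ k → joyalCoeff k ≡ sgn k ℚ.* (1 /! suc k)
joyalCoeff≡sgn*1/! k = trans (joyalCoeff≡sgnℤ/ k) (sgnℤ-/ k (suc k !) {{suc k !≢0}})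

telescope : ∀ (t : ℕ → ℚ) n → sum (applyUpTo (λ k → t k ℚ.- t (suc k)) n) ≡ t 0 ℚ.- t n
telescope t zero    = sym (ℚ.+-inverseʳ (t 0))
telescope t (suc n) = begin
  t 0 ℚ.- t 1 ℚ.+ sum (applyUpTo (λ k → t (suc k) ℚ.- t (suc (suc k))) n)
    ≡⟨ cong (t 0 ℚ.- t 1 ℚ.+_) (telescope (t ∘ suc) n) ⟩
  t 0 ℚ.- t 1 ℚ.+ (t 1 ℚ.- t (suc n))
    ≡⟨ cancel (t 0) (t 1) (t (suc n)) ⟩
  t 0 ℚ.- t (suc n) ∎
  where
  cancel : ∀ x y z → x ℚ.- y ℚ.+ (y ℚ.- z) ≡ x ℚ.- z
  cancel = RingSolver.solve-∀ ℚ-ring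

alternating-binomial : ∀ n → sum (map (λ k → sgn k ℚ.* fromℕ (suc n C suc k)) (upTo (suc n))) ≡ 1ℚ
alternating-binomial n = begin
  sum (map (λ k → sgn k ℚ.* fromℕ (suc n C suc k)) (upTo (suc n)))
    ≡⟨ cong sum (map-cong pascal (upTo (suc n))) ⟩
  sum (map (λ k → t k ℚ.- t (suc k)) (upTo (suc n)))
    ≡⟨ cong sum (map-upTo (λ k → t k ℚ.- t (suc k)) (suc n)) ⟩
  sum (applyUpTo (λ k → t k ℚ.- t (suc k)) (suc n))
    ≡⟨ telescope t (suc n) ⟩
  1ℚ ℚ.- sgn (suc n) ℚ.* fromℕ (n C suc n)
    ≡⟨ cong (λ i → 1ℚ ℚ.- sgn (suc n) ℚ.* fromℕ i) (k>n⇒nCk≡0 (n<1+n n)) ⟩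
  1ℚ ℚ.- sgn (suc n) ℚ.* 0ℚ
    ≡⟨ cong (λ x → 1ℚ ℚ.- x) (ℚ.*-zeroʳ (sgn (suc n))) ⟩
  1ℚ ∎
  where
  t : ℕ → ℚ
  t k = sgn k ℚ.* fromℕ (n C k)
  expand : ∀ s x y → s ℚ.* (x ℚ.+ y) ≡ s ℚ.* x ℚ.- ℚ.- s ℚ.* y
  expand = RingSolver.solve-∀ ℚ-ring
  pascal : ∀ k → sgn k ℚ.* fromℕ (suc n C suc k) ≡ t k ℚ.- t (suc k)
  pascal k = begin
    sgn k ℚ.* fromℕ (suc n C suc k)
      ≡⟨ cong (λ i → sgn k ℚ.* fromℕ i) (nCk+nC[k+1]≡[n+1]C[k+1] n k) ⟨
    sgn k ℚ.* fromℕ (n C k + n C suc k)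
      ≡⟨ cong (sgn k ℚ.*_) (fromℕ-+ (n C k) (n C suc k)) ⟩
    sgn k ℚ.* (fromℕ (n C k) ℚ.+ fromℕ (n C suc k))
      ≡⟨ expand (sgn k) (fromℕ (n C k)) (fromℕ (n C suc k)) ⟩
    t k ℚ.- t (suc k) ∎

joyalCoeff-sum : ∀ n → sum (map (λ k → joyalCoeff k ℚ.* (n ! /! (n ∸ k))) (upTo (suc n))) ≡ + 1 / suc n
joyalCoeff-sum n = begin
  sum (map (λ k → joyalCoeff k ℚ.* (n ! /! (n ∸ k))) (upTo (suc n)))
    ≡⟨ cong sum (map-cong-local (applyUpTo⁺₁ id (suc n) (term ∘ ≤-pred))) ⟩
  sum (map (λ k → sgn k ℚ.* fromℕ (suc n C suc k) ℚ.* (+ 1 / suc n)) (upTo (suc n)))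
    ≡⟨ *-distribʳ-sum (+ 1 / suc n) (λ k → sgn k ℚ.* fromℕ (suc n C suc k)) (upTo (suc n)) ⟨
  sum (map (λ k → sgn k ℚ.* fromℕ (suc n C suc k)) (upTo (suc n))) ℚ.* (+ 1 / suc n)
    ≡⟨ cong (ℚ._* (+ 1 / suc n)) (alternating-binomial n) ⟩
  1ℚ ℚ.* (+ 1 / suc n)
    ≡⟨ ℚ.*-identityˡ (+ 1 / suc n) ⟩
  + 1 / suc n ∎
  where
  binomial : ∀ {k} → k ≤ n → (1 /! suc k) ℚ.* (n ! /! (n ∸ k)) ≡ fromℕ (suc n C suc k) ℚ.* (+ 1 / suc n)
  binomial {k} k≤n = trans
    (normalize-*-cross 1 (suc k !) (n !) ((n ∸ k) !) (suc n C suc k) (suc n) {{suc k !≢0}} {{(n ∸ k) !≢0}}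
      (trans (reorder (n !) n) (sym (nCk*[k!*[n∸k]!]≡n! (s≤s k≤n)))))
    (sym (normalize-*-cross (suc n C suc k) 1 1 (suc n) (suc n C suc k) (suc n)
      (*-assoc (suc n C suc k) 1 (suc n))))
    where
    reorder : ∀ f n → 1 * f * (1 + n) ≡ (1 + n) * f
    reorder = solve-∀
  term : ∀ {k} → k ≤ n → joyalCoeff k ℚ.* (n ! /! (n ∸ k)) ≡ sgn k ℚ.* fromℕ (suc n C suc k) ℚ.* (+ 1 / suc n)
  term {k} k≤n = begin
    joyalCoeff k ℚ.* (n ! /! (n ∸ k))
      ≡⟨ cong (ℚ._* (n ! /! (n ∸ k))) (joyalCoeff≡sgn*1/! k) ⟩
    sgn k ℚ.* (1 /! suc k) ℚ.* (n ! /! (n ∸ k))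
      ≡⟨ ℚ.*-assoc (sgn k) (1 /! suc k) (n ! /! (n ∸ k)) ⟩
    sgn k ℚ.* ((1 /! suc k) ℚ.* (n ! /! (n ∸ k)))
      ≡⟨ cong (sgn k ℚ.*_) (binomial k≤n) ⟩
    sgn k ℚ.* (fromℕ (suc n C suc k) ℚ.* (+ 1 / suc n))
      ≡⟨ ℚ.*-assoc (sgn k) (fromℕ (suc n C suc k)) (+ 1 / suc n) ⟨
    sgn k ℚ.* fromℕ (suc n C suc k) ℚ.* (+ 1 / suc n) ∎

gen-∫ⱽ : ∀ {Φ} → Graded Φ → gen (∫ⱽ Φ) ≗ˢ ∫ˢ (gen Φ)
gen-∫ⱽ gΦ zero = refl
gen-∫ⱽ {Φ} gΦ (suc n) = begin
  gen (∫ⱽ Φ) (suc n)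
    ≡⟨ sum-map-concatMap (coeff (suc n)) (λ k → (joyalCoeff k •ⱽ Θ k) (suc n)) (upTo (suc n)) ⟩
  sum (map (λ k → gen (joyalCoeff k •ⱽ Θ k) (suc n)) (upTo (suc n)))
    ≡⟨ cong sum (map-cong-local (applyUpTo⁺₁ id (suc n) (summand ∘ ≤-pred))) ⟩
  sum (map (λ k → joyalCoeff k ℚ.* (n ! /! (n ∸ k)) ℚ.* gen Φ n) (upTo (suc n)))
    ≡⟨ *-distribʳ-sum (gen Φ n) (λ k → joyalCoeff k ℚ.* (n ! /! (n ∸ k))) (upTo (suc n)) ⟨
  sum (map (λ k → joyalCoeff k ℚ.* (n ! /! (n ∸ k))) (upTo (suc n))) ℚ.* gen Φ n
    ≡⟨ cong (ℚ._* gen Φ n) (joyalCoeff-sum n) ⟩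
  (+ 1 / suc n) ℚ.* gen Φ n ∎
  where
  Θ : ℕ → ℚVir
  Θ k = 𝕏^ (suc k) *ⱽ ∂ⱽ^ k Φ
  gen-Θ : ∀ {k} → k ≤ n → gen (Θ k) (suc n) ≡ (n ! /! (n ∸ k)) ℚ.* gen Φ n
  gen-Θ {k} k≤n = begin
    gen (Θ k) (suc n)
      ≡⟨ gen-𝕏^*ⱽ (suc k) (graded-∂ⱽ^ k gΦ) (s≤s k≤n) ⟩
    gen (∂ⱽ^ k Φ) (n ∸ k)
      ≡⟨ gen-∂ⱽ^ k Φ (n ∸ k) ⟩
    ((k + (n ∸ k)) ! /! (n ∸ k)) ℚ.* gen Φ (k + (n ∸ k))
      ≡⟨ cong (λ m → (m ! /! (n ∸ k)) ℚ.* gen Φ m) (m+[n∸m]≡n k≤n) ⟩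
    (n ! /! (n ∸ k)) ℚ.* gen Φ n ∎
  summand : ∀ {k} → k ≤ n →
            gen (joyalCoeff k •ⱽ Θ k) (suc n) ≡ joyalCoeff k ℚ.* (n ! /! (n ∸ k)) ℚ.* gen Φ n
  summand {k} k≤n = begin
    gen (joyalCoeff k •ⱽ Θ k) (suc n)                 ≡⟨ gen-•ⱽ (joyalCoeff k) (Θ k) (suc n) ⟩
    joyalCoeff k ℚ.* gen (Θ k) (suc n)                ≡⟨ cong (joyalCoeff k ℚ.*_) (gen-Θ k≤n) ⟩
    joyalCoeff k ℚ.* ((n ! /! (n ∸ k)) ℚ.* gen Φ n)   ≡⟨ ℚ.*-assoc (joyalCoeff k) _ (gen Φ n) ⟨
    joyalCoeff k ℚ.* (n ! /! (n ∸ k)) ℚ.* gen Φ n     ∎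

proposition2p25 :
    (gen 1ⱽ ≗ˢ 1ˢ)
    × (∀ (Φ Ψ : ℚVir) → WellFormed Φ → WellFormed Ψ →
         (gen (Φ +ⱽ Ψ) ≗ˢ (gen Φ +ˢ gen Ψ))
         × (gen (Φ *ⱽ Ψ) ≗ˢ (gen Φ *ˢ gen Ψ)))
    × (∀ (Φ : ℚVir) → WellFormed Φ →
         (gen (∂ⱽ Φ) ≗ˢ dˢ (gen Φ))
         × (gen (∫ⱽ Φ) ≗ˢ ∫ˢ (gen Φ)))
proposition2p25 =
    gen-1ⱽ
  , (λ Φ Ψ wfΦ wfΨ → gen-+ⱽ Φ Ψ , gen-*ⱽ (wellFormed⇒graded wfΦ) (wellFormed⇒graded wfΨ))
  , (λ Φ wfΦ → gen-∂ⱽ Φ , gen-∫ⱽ (wellFormed⇒graded wfΦ))
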